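{- Let $k \geq 5$ be an integer and let $G$ be a finite connected graph that contains neither the path $P_k$ on $k$ vertices nor the claw $K_{1,3}$ as an induced subgraph. Then $c(G) \leq k-3$.
   Context: Cops and Robber game on a finite connected graph $G$: a player controlling $k$ cops places them on vertices (not necessarily distinct), then the robber is placed on a vertex; then the cops and the robber alternately move, each piece in its turn either moving to an adjacent vertex or staying put. The cops win if after finitely many rounds some cop occupies the same vertex as the robber; both sides have complete information. The cop number $c(G)$ is the minimum number of cops that can guarantee capture of the robber on $G$. $P_k$ denotes the path on $k$ vertices. -}

module Defs where

open import Data.Nat using (ℕ; zero; suc; _≤_; _∸_)
open import Data.Fin using (Fin; zero; suc; toℕ)
open import Data.Bool using (Bool; true; false; T)
open import Data.Product using (Σ; ∃; ∃-syntax; _×_; _,_)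
open import Data.Sum using (_⊎_)
open import Data.Empty using (⊥)
open import Data.Unit using (⊤)
open import Relation.Nullary using (¬_)
open import Relation.Binary.PropositionalEquality using (_≡_)
open import Function.Definitions using (Injective)

record Graph : Set where
  field
    n     : ℕ
    adj   : Fin n → Fin n → Bool
    sym   : ∀ u v → adj u v ≡ adj v u
    irrefl : ∀ v → adj v v ≡ false

open Graph public

Vertex : Graph → Set
Vertex G = Fin (n G)

E : (G : Graph) → Vertex G → Vertex G → Set
E G u v = T (adj G u v)

data Reach (G : Graph) : Vertex G → Vertex G → Set where
  here : ∀ {v} → Reach G v v
  step : ∀ {u v w} → E G u v → Reach G v w → Reach G u w

Connected : Graph → Set
Connected G = Vertex G × (∀ u v → Reach G u v)

PathAdj : ∀ {k} → Fin k → Fin k → Set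
PathAdj i j = (suc (toℕ i) ≡ toℕ j) ⊎ (suc (toℕ j) ≡ toℕ i)

HasInducedPath : Graph → ℕ → Set
HasInducedPath G k =
  Σ (Fin k → Vertex G) λ f →
    Injective _≡_ _≡_ f ×
    (∀ i j → (E G (f i) (f j) → PathAdj i j) × (PathAdj i j → E G (f i) (f j)))

ClawAdj : Fin 4 → Fin 4 → Set
ClawAdj zero zero = ⊥
ClawAdj zero (suc _) = ⊤
ClawAdj (suc _) zero = ⊤
ClawAdj (suc _) (suc _) = ⊥

HasInducedClaw : Graph → Set
HasInducedClaw G =
  Σ (Fin 4 → Vertex G) λ f →
    Injective _≡_ _≡_ f ×
    (∀ i j → (E G (f i) (f j) → ClawAdj i j) × (ClawAdj i j → E G (f i) (f j)))

Move : (G : Graph) → Vertex G → Vertex G → Set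
Move G u v = (u ≡ v) ⊎ E G u v

Cops : Graph → ℕ → Set
Cops G m = Fin m → Vertex G

Caught : (G : Graph) {m : ℕ} → Cops G m → Vertex G → Set
Caught G c r = ∃[ i ] (c i ≡ r)

-- CopsWin G m c r : from the position (cops at c, robber at r, cops to move),
-- the cops have a strategy capturing the robber after finitely many rounds
-- against every robber play.  (Inductive = well-founded game tree.)
data CopsWin (G : Graph) (m : ℕ) : Cops G m → Vertex G → Set where
  caught : ∀ {c r} → Caught G c r → CopsWin G m c r
  move   : ∀ {c r} (c' : Cops G m) → (∀ i → Move G (c i) (c' i)) →
           (Caught G c' r ⊎ (∀ r' → Move G r r' → CopsWin G m c' r')) →
           CopsWin G m c r

-- m cops can guarantee capture on G (i.e. c(G) ≤ m): the cops choose
-- initial positions, then the robber chooses his, then play alternates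
-- starting with the cops.
CopNumber≤ : Graph → ℕ → Set
CopNumber≤ G m = Σ (Cops G m) λ c₀ → ∀ r₀ → CopsWin G m c₀ r₀

-- The cops keep an induced path p₀ … p_{L-1} (L ≤ k − 3) with one cop on each
-- of its vertices, and the robber inside the territory he can reach avoiding the
-- closed neighbourhood of the path. Among the vertices through which he could
-- leave it, let u be one whose first neighbour p_m on the path comes latest;
-- p₀ … p_m u followed by a neighbour of u in the territory is an induced path,
-- so m + 1 ≤ k − 3. If m + 1 < k − 3, a spare cop walks to u while the cops on
-- p₀ … p_m keep the robber in his territory, and the path p₀ … p_m u then
-- shrinks the territory. If m + 1 = k − 3, P_k-freeness makes u adjacent to
-- the whole territory: the cop on p_m steps to u, and an escape through a
-- neighbour x of p_m would make p_m, p_{m−1}, u, x a claw.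

module Submission where

open import Defs hiding (sym)
open import Data.Nat using (ℕ; zero; suc; _+_; _<_; _≤_; _∸_; z≤n; s≤s)
open import Data.Nat.Properties
  using (≤-refl; ≤-reflexive; ≤-pred; <-trans; <-≤-trans; ≤-<-trans; <⇒≤; <⇒≢; <⇒≱; ≰⇒>; ≤∧≢⇒<;
         <-irrefl; n<1+n; n≤1+n; m≤n⇒m≤1+n; m<1+n⇒m<n∨m≡n; m≤n⇒m<n∨m≡n; suc-injective; anyUpTo?)
open import Data.Nat.Instances
open import Data.Fin using (Fin; suc; toℕ; fromℕ<)
open import Data.Fin.Patterns using (0F; 1F; 2F; 3F)
open import Data.Fin.Properties using (toℕ-injective; toℕ<n; toℕ-fromℕ<; any?)
open import Data.Fin.Instances
open import Data.Fin.Subset using (Subset; _∈_; _∉_; _⊆_; _-_; ∣_∣)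
open import Data.Fin.Subset.Properties
  using (_∈?_; x∈p∧x≢y⇒x∈p-y; p─q⊆p; x∈p⇒∣p-x∣<∣p∣; p⊂q⇒∣p∣<∣q∣)
open import Data.Vec using (tabulate)
open import Data.Vec.Properties using (lookup∘tabulate; []=⇒lookup; lookup⇒[]=)
open import Data.List using (List; upTo; filter; allFin)
open import Data.List.Extrema.Nat
  using (argmax; min; argmin-all; argmax-all; min≤⊤; min≤xs; f[xs]≤f[argmax])
open import Data.List.Membership.Propositional.Properties using (∈-filter⁺; ∈-upTo⁺; ∈-allFin)
open import Data.List.Relation.Unary.All as All using ()
open import Data.List.Relation.Unary.All.Properties using (all-filter)
open import Data.Bool using (T; if_then_else_)
open import Data.Product using (∃; ∃-syntax; _×_; _,_; proj₁; proj₂)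
open import Data.Sum using (_⊎_; inj₁; inj₂; [_,_]′)
open import Data.Unit using (tt)
open import Data.Empty using (⊥; ⊥-elim)
open import Function using (_∘_; id)
open import Level using (0ℓ)
open import Relation.Nullary using (¬_; Dec; yes; no; does; contradiction)
open import Relation.Nullary.Decidable using (_×-dec_; _⊎-dec_; ¬?; map′; dec-true; T?)
open import Relation.Unary using (Pred; Decidable)
open import Relation.Binary.PropositionalEquality
  using (_≡_; _≢_; ≢-sym; refl; sym; trans; cong; subst; subst₂)
open import Relation.Binary.Structures using (IsDecEquivalence)
open import Relation.Binary.TypeClasses using (_≟_)

module _ {A B : Set} {{_ : IsDecEquivalence {A = A} _≡_}} where

  _[_]≔_ : (A → B) → A → B → A → B
  (f [ a ]≔ b) x = if does (x ≟ a) then b else f x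

  []≔-elim : ∀ (P : B → Set) (f : A → B) a b x →
             (x ≡ a → P b) → (x ≢ a → P (f x)) → P ((f [ a ]≔ b) x)
  []≔-elim P f a b x pb pfx with x ≟ a
  ... | yes x≡a = pb x≡a
  ... | no x≢a  = pfx x≢a

  []≔-at : ∀ (f : A → B) a b → (f [ a ]≔ b) a ≡ b
  []≔-at f a b = []≔-elim (_≡ b) f a b a (λ _ → refl) (λ a≢a → contradiction refl a≢a)

  []≔-≢ : ∀ (f : A → B) {a} b {x} → x ≢ a → (f [ a ]≔ b) x ≡ f x
  []≔-≢ f {a} b {x} x≢a =
    []≔-elim (_≡ f x) f a b x (λ x≡a → contradiction x≡a x≢a) (λ _ → refl)

module _ {P : Pred ℕ 0ℓ} (P? : Decidable P) where

  -- least L = L when no index below L satisfies P. Opaque, like the other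
  -- list searches below: unfolding them makes unification very slow.
  opaque
    least : ℕ → ℕ
    least L = min L (filter P? (upTo L))

    least-≤ : ∀ {L i} → i < L → P i → least L ≤ i
    least-≤ {L} i<L pi = All.lookup (min≤xs L (filter P? (upTo L))) (∈-filter⁺ P? (∈-upTo⁺ i<L) pi)

    least-holds : ∀ {L} → least L < L → P (least L)
    least-holds {L} = argmin-all id {P = λ i → i < L → P i} (λ L<L → ⊥-elim (<-irrefl refl L<L))
                        (All.map (λ pi _ → pi) (all-filter P? (upTo L)))

    least-minimal : ∀ {L i} → i < least L → ¬ P i
    least-minimal {L} i<m pi = <⇒≱ i<m (least-≤ (<-≤-trans i<m (min≤⊤ L (filter P? (upTo L)))) pi)

module _ {n : ℕ} {P : Pred (Fin n) 0ℓ} (P? : Decidable P) where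

  opaque
    subset : Subset n
    subset = tabulate (does ∘ P?)

    ∈-subset⁺ : ∀ {x} → P x → x ∈ subset
    ∈-subset⁺ {x} px = lookup⇒[]= x subset (trans (lookup∘tabulate (does ∘ P?) x) (dec-true (P? x) px))

    ∈-subset⁻ : ∀ {x} → x ∈ subset → P x
    ∈-subset⁻ {x} x∈ with P? x | trans (sym (lookup∘tabulate (does ∘ P?) x)) ([]=⇒lookup x∈)
    ... | yes px | _ = px

    ∃-argmax : (f : Fin n → ℕ) → ∃ P → ∃ λ u → P u × (∀ {x} → P x → f x ≤ f u)
    ∃-argmax f (x₀ , px₀) =
      u , argmax-all f px₀ (all-filter P? (allFin n)) ,
      λ px → All.lookup (f[xs]≤f[argmax] x₀ candidates) (∈-filter⁺ P? (∈-allFin _) px)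
      where
        candidates : List (Fin n)
        candidates = filter P? (allFin n)

        u : Fin n
        u = argmax f x₀ candidates

module GraphTheory (G : Graph) where

  V : Set
  V = Vertex G

  E-sym : ∀ {u v} → E G u v → E G v u
  E-sym {u} {v} = subst T (Graph.sym G u v)

  E-irrefl : ∀ {v} → ¬ E G v v
  E-irrefl {v} = subst T (Graph.irrefl G v)

  E⇒≢ : ∀ {u v} → E G u v → u ≢ v
  E⇒≢ e refl = E-irrefl e

  E? : ∀ u v → Dec (E G u v)
  E? u v = T? (adj G u v)

  Move? : ∀ u v → Dec (Move G u v)
  Move? u v = (u ≟ v) ⊎-dec E? u v

  data WalkIn (A : Subset (n G)) : V → V → Set where
    []   : ∀ {x} → WalkIn A x x
    step : ∀ {x y z} → E G x y → y ∈ A → WalkIn A y z → WalkIn A x z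

  module _ {A : Subset (n G)} where

    last∈ : ∀ {x y} → x ∈ A → WalkIn A x y → y ∈ A
    last∈ x∈A []             = x∈A
    last∈ _   (step _ y∈A w) = last∈ y∈A w

    _∷ʳ_ : ∀ {x y z} → WalkIn A x y → E G y z × z ∈ A → WalkIn A x z
    []             ∷ʳ (e , z∈A) = step e z∈A []
    step e y∈A w   ∷ʳ ez        = step e y∈A (w ∷ʳ ez)

    _++_ : ∀ {x y z} → WalkIn A x y → WalkIn A y z → WalkIn A x z
    []           ++ w′ = w′
    step e y∈A w ++ w′ = step e y∈A (w ++ w′)

    reverse : ∀ {x y} → x ∈ A → WalkIn A x y → WalkIn A y x
    reverse x∈A []             = []
    reverse x∈A (step e y∈A w) = reverse y∈A w ∷ʳ (E-sym e , x∈A)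

    WalkIn-mono : ∀ {B x y} → A ⊆ B → WalkIn A x y → WalkIn B x y
    WalkIn-mono A⊆B []             = []
    WalkIn-mono A⊆B (step e y∈A w) = step e (A⊆B y∈A) (WalkIn-mono A⊆B w)

    WalkIn-avoid : ∀ z {x y} → WalkIn A x y → WalkIn (A - z) x y ⊎ WalkIn (A - z) z y
    WalkIn-avoid z [] = inj₁ []
    WalkIn-avoid z (step {y = v} e v∈A w) with WalkIn-avoid z w
    ... | inj₂ w′ = inj₂ w′
    ... | inj₁ w′ with v ≟ z
    ...   | yes refl = inj₂ w′
    ...   | no v≢z   = inj₁ (step e (x∈p∧x≢y⇒x∈p-y v∈A v≢z) w′)

    shortcut : ∀ {x y} → WalkIn A x y → WalkIn (A - x) x y
    shortcut {x} w = [ id , id ]′ (WalkIn-avoid x w)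

  -- Recursion on ∣ A ∣: a walk may leave x towards a vertex z it never
  -- revisits, so the rest of it lies in A - z.
  walkIn-bounded? : ∀ k (A : Subset (n G)) → ∣ A ∣ < k → ∀ x y → Dec (WalkIn A x y)
  walkIn-bounded? (suc k) A ∣A∣≤k x y with x ≟ y
  ... | yes refl = yes []
  ... | no x≢y  = map′ fromStep toStep (any? firstStep?)
    where
      FirstStep : V → Set
      FirstStep z = E G x z × z ∈ A × WalkIn (A - z) z y

      firstStep? : Decidable FirstStep
      firstStep? z with z ∈? A
      ... | no z∉A  = no (z∉A ∘ proj₁ ∘ proj₂)
      ... | yes z∈A = map′ (λ (e , w) → e , z∈A , w) (λ (e , _ , w) → e , w)
                        (E? x z ×-dec walkIn-bounded? k (A - z) ∣A-z∣<k z y)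
        where
          ∣A-z∣<k : ∣ A - z ∣ < k
          ∣A-z∣<k = <-≤-trans (x∈p⇒∣p-x∣<∣p∣ z∈A) (≤-pred ∣A∣≤k)

      fromStep : ∃ FirstStep → WalkIn A x y
      fromStep (_ , e , z∈A , w) = step e z∈A (WalkIn-mono (p─q⊆p A _) w)

      toStep : WalkIn A x y → ∃ FirstStep
      toStep []             = contradiction refl x≢y
      toStep (step e z∈A w) = _ , e , z∈A , shortcut w

  walkIn? : ∀ A x y → Dec (WalkIn A x y)
  walkIn? A = walkIn-bounded? (suc ∣ A ∣) A ≤-refl

  opaque
    territory : Subset (n G) → V → Subset (n G)
    territory A a = subset (walkIn? A a)

    ∈-territory⁺ : ∀ {A a x} → WalkIn A a x → x ∈ territory A a
    ∈-territory⁺ {A} {a} = ∈-subset⁺ (walkIn? A a)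

    ∈-territory⁻ : ∀ {A a x} → x ∈ territory A a → WalkIn A a x
    ∈-territory⁻ {A} {a} = ∈-subset⁻ (walkIn? A a)

  Boundary : Subset (n G) → V → V → Set
  Boundary A a x = ¬ WalkIn A a x × ∃[ y ] WalkIn A a y × E G y x

  boundary? : ∀ A a → Decidable (Boundary A a)
  boundary? A a x = ¬? (walkIn? A a x) ×-dec any? (λ y → walkIn? A a y ×-dec E? y x)

  module _ {A : Subset (n G)} {a : V} (a∈A : a ∈ A) where

    boundary-∉ : ∀ {x} → Boundary A a x → x ∉ A
    boundary-∉ (¬w , _ , w , e) x∈A = ¬w (w ∷ʳ (e , x∈A))

    step-or-boundary : ∀ {r r′} → WalkIn A a r → Move G r r′ → WalkIn A a r′ ⊎ Boundary A a r′
    step-or-boundary w (inj₁ refl) = inj₁ w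
    step-or-boundary {r′ = r′} w (inj₂ e) with r′ ∈? A
    ... | yes r′∈A = inj₁ (w ∷ʳ (e , r′∈A))
    ... | no r′∉A  = inj₂ ((λ w′ → r′∉A (last∈ a∈A w′)) , _ , w , e)

    boundary-exists : ∀ {b} → b ∉ A → Reach G a b → ∃ (Boundary A a)
    boundary-exists b∉A = go []
      where
        go : ∀ {v} → WalkIn A a v → Reach G v _ → ∃ (Boundary A a)
        go w here            = contradiction (last∈ a∈A w) b∉A
        go w (step e reach) with step-or-boundary w (inj₂ e)
        ... | inj₁ w′ = go w′ reach
        ... | inj₂ bd = _ , bd

  record IsInducedPath (L : ℕ) (p : ℕ → V) : Set where
    field
      injective            : ∀ {i j} → i < L → j < L → p i ≡ p j → i ≡ j
      adjacent⇒consecutive : ∀ {i j} → i < L → j < L → E G (p i) (p j) → suc i ≡ j ⊎ suc j ≡ i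
      consecutive⇒adjacent : ∀ {i} → suc i < L → E G (p i) (p (suc i))

  open IsInducedPath

  single-induced : ∀ v → IsInducedPath 1 (λ _ → v)
  single-induced v = record
    { injective            = λ { (s≤s z≤n) (s≤s z≤n) _ → refl }
    ; adjacent⇒consecutive = λ _ _ e → contradiction e E-irrefl
    ; consecutive⇒adjacent = λ { (s≤s ()) }
    }

  prefix-induced : ∀ {L L′ p} → L′ ≤ L → IsInducedPath L p → IsInducedPath L′ p
  prefix-induced L′≤L path = record
    { injective            = λ i< j< → injective path (<-≤-trans i< L′≤L) (<-≤-trans j< L′≤L)
    ; adjacent⇒consecutive = λ i< j< →
                               adjacent⇒consecutive path (<-≤-trans i< L′≤L) (<-≤-trans j< L′≤L)
    ; consecutive⇒adjacent = λ i< → consecutive⇒adjacent path (<-≤-trans i< L′≤L)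
    }

  snoc-induced : ∀ {L p w} → IsInducedPath (suc L) p →
                 (∀ {i} → i ≤ L → w ≢ p i) → (∀ {i} → i < L → ¬ E G (p i) w) → E G (p L) w →
                 IsInducedPath (suc (suc L)) (p [ suc L ]≔ w)
  snoc-induced {L} {p} {w} path w∉p w≁p p~w = record
    { injective            = injective′
    ; adjacent⇒consecutive = adjacent⇒consecutive′
    ; consecutive⇒adjacent = consecutive⇒adjacent′
    }
    where
      q : ℕ → V
      q = p [ suc L ]≔ w

      old : ∀ {i} → i < suc L → q i ≡ p i
      old i< = []≔-≢ p w (<⇒≢ i<)

      new : q (suc L) ≡ w
      new = []≔-at p (suc L) w

      injective′ : ∀ {i j} → i < suc (suc L) → j < suc (suc L) → q i ≡ q j → i ≡ j
      injective′ i< j< eq with m<1+n⇒m<n∨m≡n i< | m<1+n⇒m<n∨m≡n j<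
      ... | inj₁ i<′  | inj₁ j<′  = injective path i<′ j<′ (trans (sym (old i<′)) (trans eq (old j<′)))
      ... | inj₂ refl | inj₂ refl = refl
      ... | inj₂ refl | inj₁ j<′  = contradiction (trans (sym new) (trans eq (old j<′))) (w∉p (≤-pred j<′))
      ... | inj₁ i<′  | inj₂ refl = contradiction (trans (sym new) (trans (sym eq) (old i<′)))
                                                  (w∉p (≤-pred i<′))

      new-adjacent : ∀ {j} → j < suc L → E G (p j) w → suc j ≡ suc L
      new-adjacent {j} j< e with m<1+n⇒m<n∨m≡n j<
      ... | inj₁ j<L  = contradiction e (w≁p j<L)
      ... | inj₂ refl = refl

      adjacent⇒consecutive′ : ∀ {i j} → i < suc (suc L) → j < suc (suc L) → E G (q i) (q j) →
                              suc i ≡ j ⊎ suc j ≡ i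
      adjacent⇒consecutive′ i< j< e with m<1+n⇒m<n∨m≡n i< | m<1+n⇒m<n∨m≡n j<
      ... | inj₁ i<′  | inj₁ j<′  = adjacent⇒consecutive path i<′ j<′ (subst₂ (E G) (old i<′) (old j<′) e)
      ... | inj₂ refl | inj₂ refl = contradiction e E-irrefl
      ... | inj₂ refl | inj₁ j<′  = inj₂ (new-adjacent j<′ (E-sym (subst₂ (E G) new (old j<′) e)))
      ... | inj₁ i<′  | inj₂ refl = inj₁ (new-adjacent i<′ (subst₂ (E G) (old i<′) new e))

      consecutive⇒adjacent′ : ∀ {i} → suc i < suc (suc L) → E G (q i) (q (suc i))
      consecutive⇒adjacent′ {i} i+1< with m<1+n⇒m<n∨m≡n i+1<
      ... | inj₁ i+1<′ = subst₂ (E G) (sym (old (<-trans (n<1+n i) i+1<′))) (sym (old i+1<′))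
                                 (consecutive⇒adjacent path i+1<′)
      ... | inj₂ refl  = subst₂ (E G) (sym (old ≤-refl)) (sym new) p~w

  IsInducedPath⇒HasInducedPath : ∀ {k p} → IsInducedPath k p → HasInducedPath G k
  IsInducedPath⇒HasInducedPath {k} {p} path = p ∘ toℕ , inj , λ i j → to i j , from i j
    where
      inj : ∀ {i j} → p (toℕ i) ≡ p (toℕ j) → i ≡ j
      inj {i} {j} eq = toℕ-injective (injective path (toℕ<n i) (toℕ<n j) eq)

      to : ∀ i j → E G (p (toℕ i)) (p (toℕ j)) → PathAdj i j
      to i j = adjacent⇒consecutive path (toℕ<n i) (toℕ<n j)

      forward : ∀ {i j} → suc (toℕ i) ≡ toℕ j → E G (p (toℕ i)) (p (toℕ j))
      forward {i} {j} eq = subst (λ b → E G (p (toℕ i)) (p b)) eq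
                             (consecutive⇒adjacent path (subst (_< k) (sym eq) (toℕ<n j)))

      from : ∀ i j → PathAdj i j → E G (p (toℕ i)) (p (toℕ j))
      from i j (inj₁ eq) = forward eq
      from i j (inj₂ eq) = E-sym (forward eq)

  claw : ∀ {c l₁ l₂ l₃} → E G c l₁ → E G c l₂ → E G c l₃ →
         ¬ E G l₁ l₂ → ¬ E G l₁ l₃ → ¬ E G l₂ l₃ →
         l₁ ≢ l₂ → l₁ ≢ l₃ → l₂ ≢ l₃ → HasInducedClaw G
  claw {c} {l₁} {l₂} {l₃} e₁ e₂ e₃ n₁₂ n₁₃ n₂₃ d₁₂ d₁₃ d₂₃ =
    f , inj , λ i j → to i j , from i j
    where
      f : Fin 4 → V
      f 0F = c
      f 1F = l₁
      f 2F = l₂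
      f 3F = l₃

      from : ∀ i j → ClawAdj i j → E G (f i) (f j)
      from 0F 1F _ = e₁
      from 0F 2F _ = e₂
      from 0F 3F _ = e₃
      from 1F 0F _ = E-sym e₁
      from 2F 0F _ = E-sym e₂
      from 3F 0F _ = E-sym e₃

      inj : ∀ {i j} → f i ≡ f j → i ≡ j
      inj {0F} {0F} _ = refl
      inj {0F} {suc l} eq = contradiction eq (E⇒≢ (from 0F (suc l) tt))
      inj {suc l} {0F} eq = contradiction eq (E⇒≢ (from (suc l) 0F tt))
      inj {1F} {1F} _ = refl
      inj {2F} {2F} _ = refl
      inj {3F} {3F} _ = refl
      inj {1F} {2F} eq = contradiction eq d₁₂
      inj {1F} {3F} eq = contradiction eq d₁₃
      inj {2F} {3F} eq = contradiction eq d₂₃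
      inj {2F} {1F} eq = contradiction (sym eq) d₁₂
      inj {3F} {1F} eq = contradiction (sym eq) d₁₃
      inj {3F} {2F} eq = contradiction (sym eq) d₂₃

      to : ∀ i j → E G (f i) (f j) → ClawAdj i j
      to 0F 0F e = E-irrefl e
      to 0F (suc _) _ = tt
      to (suc _) 0F _ = tt
      to 1F 1F e = E-irrefl e
      to 2F 2F e = E-irrefl e
      to 3F 3F e = E-irrefl e
      to 1F 2F e = n₁₂ e
      to 1F 3F e = n₁₃ e
      to 2F 3F e = n₂₃ e
      to 2F 1F e = n₁₂ (E-sym e)
      to 3F 1F e = n₁₃ (E-sym e)
      to 3F 2F e = n₂₃ (E-sym e)

module CopsAndRobber (G : Graph) (K : ℕ) where
  open GraphTheory G

  Near : Cops G K → V → Set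
  Near c x = ∃[ i ] Move G (c i) x

  near? : ∀ c x → Dec (Near c x)
  near? c x = any? (λ i → Move? (c i) x)

  move-one : ∀ (c : Cops G K) {i v} → E G (c i) v → ∀ j → Move G (c j) ((c [ i ]≔ v) j)
  move-one c {i} {v} e j = []≔-elim (Move G (c j)) c i v j (λ { refl → inj₂ e }) (λ _ → inj₁ refl)

  capture : ∀ {c r} → Near c r → CopsWin G K c r
  capture     (i , inj₁ c-i≡r) = caught (i , c-i≡r)
  capture {c} (i , inj₂ e)     = move (c [ i ]≔ _) (move-one c e) (inj₁ (i , []≔-at c i _))

  capture-or : ∀ {c r} → (¬ Near c r → CopsWin G K c r) → CopsWin G K c r
  capture-or {c} {r} otherwise with near? c r
  ... | yes near = capture near
  ... | no ¬near = otherwise ¬near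

  cops-move : ∀ {c r} c′ → (∀ i → Move G (c i) (c′ i)) →
              (∀ {r′} → Move G r r′ → ¬ Near c′ r′ → CopsWin G K c′ r′) → CopsWin G K c r
  cops-move c′ legal respond = move c′ legal (inj₂ λ r′ mv → capture-or (respond mv))

  walk-cop : (Inv : Cops G K → V → Set) (i : Fin K) {u : V} →
             (∀ {c r v r′} → Inv c r → E G (c i) v → Move G r r′ → ¬ Near (c [ i ]≔ v) r′ →
                Inv (c [ i ]≔ v) r′) →
             (∀ {c r} → Inv c r → c i ≡ u → CopsWin G K c r) →
             ∀ {c r s} → Reach G s u → c i ≡ s → Inv c r → CopsWin G K c r
  walk-cop Inv i preserve arrive here c-i≡s inv = arrive inv c-i≡s
  walk-cop Inv i preserve arrive {c} (step e route) refl inv =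
    cops-move (c [ i ]≔ _) (move-one c e) λ mv ¬near →
      walk-cop Inv i preserve arrive route ([]≔-at c i _) (preserve inv e mv ¬near)

module Strategy (G : Graph) (j : ℕ) (conn : Connected G)
                (noP : ¬ HasInducedPath G (5 + j)) (noC : ¬ HasInducedClaw G) where
  open GraphTheory G
  open IsInducedPath

  K : ℕ
  K = 2 + j

  open CopsAndRobber G K

  NearPath : ℕ → (ℕ → V) → V → Set
  NearPath L p x = ∃ λ i → i < L × Move G (p i) x

  nearPath? : ∀ L p x → Dec (NearPath L p x)
  nearPath? L p x = anyUpTo? (λ i → Move? (p i) x) L

  opaque
    safe : ℕ → (ℕ → V) → Subset (n G)
    safe L p = subset (¬? ∘ nearPath? L p)

    safe⁺ : ∀ {L p x} → ¬ NearPath L p x → x ∈ safe L p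
    safe⁺ {L} {p} = ∈-subset⁺ (¬? ∘ nearPath? L p)

    safe⁻ : ∀ {L p x i} → x ∈ safe L p → i < L → ¬ Move G (p i) x
    safe⁻ {L} {p} x∈ i< mv = ∈-subset⁻ (¬? ∘ nearPath? L p) x∈ (_ , i< , mv)

  record Guarded (L : ℕ) (p : ℕ → V) (c : Cops G K) : Set where
    constructor guarded
    field on-path : ∀ i → toℕ i < L → c i ≡ p (toℕ i)

  open Guarded

  guard-near : ∀ {L p c x i} → Guarded L p c → L ≤ K → i < L → Move G (p i) x → Near c x
  guard-near {L} {p} {c} {x} {i} g L≤K i<L mv = cop , subst (λ v → Move G v x) (sym c-cop≡p-i) mv
    where
      cop : Fin K
      cop = fromℕ< (<-≤-trans i<L L≤K)

      c-cop≡p-i : c cop ≡ p i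
      c-cop≡p-i = trans (on-path g cop (subst (_< L) (sym (toℕ-fromℕ< _)) i<L)) (cong p (toℕ-fromℕ< _))

  guarded⇒safe : ∀ {L p c r} → Guarded L p c → L ≤ K → ¬ Near c r → r ∈ safe L p
  guarded⇒safe g L≤K ¬near = safe⁺ λ (_ , i< , mv) → ¬near (guard-near g L≤K i< mv)

  Guarded-weaken : ∀ {L L′ p c} → L′ ≤ L → Guarded L p c → Guarded L′ p c
  Guarded-weaken L′≤L g = guarded λ i i< → on-path g i (<-≤-trans i< L′≤L)

  Guarded-move : ∀ {L p c t v} → L ≤ toℕ t → Guarded L p c → Guarded L p (c [ t ]≔ v)
  Guarded-move {c = c} L≤t g = guarded λ i i< →
    trans ([]≔-≢ c _ λ { refl → <-irrefl refl (<-≤-trans i< L≤t) }) (on-path g i i<)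

  record GuardablePath (L : ℕ) (p : ℕ → V) : Set where
    field
      induced  : IsInducedPath L p
      nonempty : 0 < L
      fits     : L ≤ K

  WinsBelow : ℕ → Set
  WinsBelow N = ∀ {L p c r} → GuardablePath L p → Guarded L p c → r ∈ safe L p →
                ∣ territory (safe L p) r ∣ < N → CopsWin G K c r

  module Phase {N} (ih : WinsBelow N) {L p} (gp : GuardablePath L p) {a} (a-safe : a ∈ safe L p)
               (bounded : ∣ territory (safe L p) a ∣ ≤ N) where
    open GuardablePath gp

    A : Subset (n G)
    A = safe L p

    boundary-∉path : ∀ {x i} → Boundary A a x → i < L → x ≢ p i
    boundary-∉path (_ , _ , w , e) i< refl = safe⁻ (last∈ a-safe w) i< (inj₂ (E-sym e))

    boundary-attached : ∀ {x} → Boundary A a x → ∃ λ i → i < L × E G (p i) x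
    boundary-attached {x} bd with nearPath? L p x
    ... | yes (i , i< , inj₁ p-i≡x) = contradiction (sym p-i≡x) (boundary-∉path bd i<)
    ... | yes (i , i< , inj₂ e)     = i , i< , e
    ... | no ¬near                  = contradiction (safe⁺ ¬near) (boundary-∉ a-safe bd)

    adjacent? : ∀ x i → Dec (E G (p i) x)
    adjacent? x i = E? (p i) x

    attach : V → ℕ
    attach x = least (adjacent? x) L

    attach-< : ∀ {x} → Boundary A a x → attach x < L
    attach-< bd with boundary-attached bd
    ... | i , i< , e = ≤-<-trans (least-≤ (adjacent? _) i< e) i<

    attach-adj : ∀ {x} → Boundary A a x → E G (p (attach x)) x
    attach-adj bd = least-holds (adjacent? _) (attach-< bd)

    attach-minimal : ∀ {x i} → i < attach x → ¬ E G (p i) x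
    attach-minimal {x} = least-minimal (adjacent? x)

    farthest : ∃ λ u → Boundary A a u × (∀ {x} → Boundary A a x → attach x ≤ attach u)
    farthest = ∃-argmax (boundary? A a) attach (boundary-exists a-safe p₀∉A (proj₂ conn a (p 0)))
      where
        p₀∉A : p 0 ∉ A
        p₀∉A p₀∈A = safe⁻ p₀∈A nonempty (inj₁ refl)

    u : V
    u = proj₁ farthest

    u-boundary : Boundary A a u
    u-boundary = proj₁ (proj₂ farthest)

    m : ℕ
    m = attach u

    attach≤m : ∀ {x} → Boundary A a x → attach x ≤ m
    attach≤m = proj₂ (proj₂ farthest)

    m<L : m < L
    m<L = attach-< u-boundary

    y : V
    y = proj₁ (proj₂ u-boundary)

    y-walk : WalkIn A a y
    y-walk = proj₁ (proj₂ (proj₂ u-boundary))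

    u~y : E G u y
    u~y = E-sym (proj₂ (proj₂ (proj₂ u-boundary)))

    far-from-path : ∀ {v i} → v ∈ A → i ≤ m → ¬ Move G (p i) v
    far-from-path v∈A i≤m = safe⁻ v∈A (≤-<-trans i≤m m<L)

    safe≢u : ∀ {v} → v ∈ A → v ≢ u
    safe≢u v∈A refl = boundary-∉ a-safe u-boundary v∈A

    q : ℕ → V
    q = p [ suc m ]≔ u

    q-old : ∀ {i} → i ≤ m → q i ≡ p i
    q-old i≤m = []≔-≢ p u (<⇒≢ (s≤s i≤m))

    q-new : q (suc m) ≡ u
    q-new = []≔-at p (suc m) u

    q-elim : ∀ (P : V → Set) {i} → i ≤ suc m → P u → (i ≤ m → P (p i)) → P (q i)
    q-elim P {i} i≤ pu pp = []≔-elim P p (suc m) u i (λ _ → pu) (λ i≢ → pp (≤-pred (≤∧≢⇒< i≤ i≢)))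

    safe∉q : ∀ {v i} → v ∈ A → i ≤ suc m → v ≢ q i
    safe∉q v∈A i≤ =
      q-elim (_ ≢_) i≤ (safe≢u v∈A) λ i≤m v≡p-i → far-from-path v∈A i≤m (inj₁ (sym v≡p-i))

    path-to-u : IsInducedPath (2 + m) q
    path-to-u = snoc-induced (prefix-induced m<L induced)
                  (λ i≤m → boundary-∉path u-boundary (≤-<-trans i≤m m<L)) attach-minimal (attach-adj u-boundary)

    path-beyond-u : ∀ {v} → v ∈ A → E G u v → IsInducedPath (3 + m) (q [ 2 + m ]≔ v)
    path-beyond-u {v} v∈A u~v =
      snoc-induced path-to-u (safe∉q v∈A) v≁q (subst (λ z → E G z v) (sym q-new) u~v)
      where
        v≁q : ∀ {i} → i < suc m → ¬ E G (q i) v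
        v≁q (s≤s i≤m) = subst (λ z → ¬ E G z v) (sym (q-old i≤m)) (far-from-path v∈A i≤m ∘ inj₂)

    -- Opaque so that fromℕ< m<K never unfolds this proof.
    opaque
      m<K : m < K
      m<K = ≰⇒> λ K≤m → noP (IsInducedPath⇒HasInducedPath
              (prefix-induced (s≤s (s≤s (s≤s K≤m))) (path-beyond-u (last∈ a-safe y-walk) u~y)))

    stays-in-territory : ∀ {v x} → WalkIn A a v → WalkIn (safe (2 + m) q) v x → WalkIn A a x
    stays-in-territory w [] = w
    stays-in-territory w (step e b∈ w′) with step-or-boundary a-safe w (inj₂ e)
    ... | inj₁ w-b = stays-in-territory w-b w′
    ... | inj₂ bd  = ⊥-elim (safe⁻ b∈ (s≤s (m≤n⇒m≤1+n (attach≤m bd)))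
                               (inj₂ (subst (λ z → E G z _) (sym (q-old (attach≤m bd))) (attach-adj bd))))

    territory-shrinks : ∀ {r} → r ∈ safe (2 + m) q → WalkIn A a r →
                        ∣ territory (safe (2 + m) q) r ∣ < ∣ territory A a ∣
    territory-shrinks {r} r-safe w =
      p⊂q⇒∣p∣<∣q∣ ((λ x∈ → ∈-territory⁺ (stays-in-territory w (∈-territory⁻ x∈))) ,
                   y , ∈-territory⁺ y-walk , y∉)
      where
        y∉ : y ∉ territory (safe (2 + m) q) r
        y∉ y∈ = safe⁻ (last∈ r-safe (∈-territory⁻ y∈)) (n<1+n (suc m))
                  (inj₂ (subst (λ z → E G z y) (sym q-new) u~y))

    module Travel (1+m<K : suc m < K) where
      t : Fin K
      t = fromℕ< 1+m<K

      Confined : Cops G K → V → Set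
      Confined c r = Guarded (suc m) p c × WalkIn A a r

      still-confined : ∀ {c r v r′} → Confined c r → E G (c t) v → Move G r r′ →
                       ¬ Near (c [ t ]≔ v) r′ → Confined (c [ t ]≔ v) r′
      still-confined {c} {v = v} {r′} (g , w) _ mv ¬near =
        g′ , [ id , escape ]′ (step-or-boundary a-safe w mv)
        where
          g′ : Guarded (suc m) p (c [ t ]≔ v)
          g′ = Guarded-move (≤-reflexive (sym (toℕ-fromℕ< 1+m<K))) g

          escape : Boundary A a r′ → WalkIn A a r′
          escape bd = ⊥-elim (¬near (guard-near g′ (<⇒≤ 1+m<K) (s≤s (attach≤m bd)) (inj₂ (attach-adj bd))))

      arrive : ∀ {c r} → Confined c r → c t ≡ u → CopsWin G K c r
      arrive {c} (g , w) c-t≡u = capture-or λ ¬near →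
        let r-safe = guarded⇒safe g′ 1+m<K ¬near in
        ih gp′ g′ r-safe (<-≤-trans (territory-shrinks r-safe w) bounded)
        where
          gp′ : GuardablePath (2 + m) q
          gp′ = record { induced = path-to-u ; nonempty = s≤s z≤n ; fits = 1+m<K }

          on-q : ∀ i → toℕ i < 2 + m → c i ≡ q (toℕ i)
          on-q i i< with m<1+n⇒m<n∨m≡n i<
          ... | inj₁ i≤m = trans (on-path g i i≤m) (sym (q-old (≤-pred i≤m)))
          ... | inj₂ i≡1+m = trans (cong c (toℕ-injective (trans i≡1+m (sym (toℕ-fromℕ< 1+m<K)))))
                                   (trans c-t≡u (trans (sym q-new) (cong q (sym i≡1+m))))

          g′ : Guarded (2 + m) q c
          g′ = guarded on-q

      win : ∀ {c} → Guarded (suc m) p c → CopsWin G K c a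
      win {c} g = walk-cop Confined t still-confined arrive (proj₂ conn (c t) u) refl (g , [])

    module Dominate (1+m≡K : suc m ≡ K) where
      longer-path : ∀ {v v′} → v ∈ A → E G u v → E G v v′ → v′ ∈ A → ¬ E G u v′ →
                    IsInducedPath (4 + m) ((q [ 2 + m ]≔ v) [ 3 + m ]≔ v′)
      longer-path {v} {v′} v∈A u~v v~v′ v′∈A u≁v′ =
        snoc-induced (path-beyond-u v∈A u~v) v′∉ v′≁
          (subst (λ z → E G z v′) (sym ([]≔-at q (2 + m) v)) v~v′)
        where

          v′∉ : ∀ {i} → i ≤ 2 + m → v′ ≢ (q [ 2 + m ]≔ v) i
          v′∉ {i} i≤ = []≔-elim (v′ ≢_) q (2 + m) v i (λ _ v′≡v → E⇒≢ v~v′ (sym v′≡v))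
                         (λ i≢ → safe∉q v′∈A (≤-pred (≤∧≢⇒< i≤ i≢)))

          v′≁ : ∀ {i} → i < 2 + m → ¬ E G ((q [ 2 + m ]≔ v) i) v′
          v′≁ {i} (s≤s i≤) = subst (λ z → ¬ E G z v′) (sym ([]≔-≢ q v (<⇒≢ (s≤s i≤))))
                               (q-elim (λ z → ¬ E G z v′) i≤ u≁v′ λ i≤m → far-from-path v′∈A i≤m ∘ inj₂)

      dominates-walk : ∀ {v x} → E G u v → v ∈ A → WalkIn A v x → E G u x
      dominates-walk u~v v∈A [] = u~v
      dominates-walk u~v v∈A (step {y = v′} v~v′ v′∈A w) with E? u v′
      ... | yes u~v′ = dominates-walk u~v′ v′∈A w
      ... | no u≁v′  = contradiction (subst (λ l → HasInducedPath G (3 + l)) 1+m≡K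
                                        (IsInducedPath⇒HasInducedPath (longer-path v∈A u~v v~v′ v′∈A u≁v′)))
                                     noP

      dominates-territory : ∀ {x} → WalkIn A a x → E G u x
      dominates-territory w = dominates-walk u~y (last∈ a-safe y-walk) (reverse a-safe y-walk ++ w)

      m≡1+j : m ≡ suc j
      m≡1+j = suc-injective 1+m≡K

      no-escape : ∀ {x} → Boundary A a x → attach x ≡ m → u ≢ x → ¬ E G u x → ⊥
      no-escape {x} bd x-at-m u≢x u≁x =
        noC (claw pm~pj (attach-adj u-boundary) pm~x (attach-minimal j<m) (attach-minimal j<attach-x)
                  u≁x (≢-sym (boundary-∉path u-boundary j<L)) (≢-sym (boundary-∉path bd j<L)) u≢x)
        where
          j<m : j < m
          j<m = subst (j <_) (sym m≡1+j) (n<1+n j)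

          j<attach-x : j < attach x
          j<attach-x = subst (j <_) (sym x-at-m) j<m

          j<L : j < L
          j<L = <-trans j<m m<L

          pm~pj : E G (p m) (p j)
          pm~pj = E-sym (subst (λ i → E G (p j) (p i)) (sym m≡1+j)
                           (consecutive⇒adjacent induced (subst (_< L) m≡1+j m<L)))

          pm~x : E G (p m) x
          pm~x = subst (λ i → E G (p i) x) x-at-m (attach-adj bd)

      win : ∀ {c} → Guarded (suc m) p c → CopsWin G K c a
      win {c} g = cops-move (c [ d ]≔ u) (move-one c c-d~u) respond
        where
          d : Fin K
          d = fromℕ< m<K

          c-d~u : E G (c d) u
          c-d~u = subst (λ z → E G z u)
                    (sym (trans (on-path g d (subst (_< suc m) (sym (toℕ-fromℕ< m<K)) ≤-refl))
                                (cong p (toℕ-fromℕ< m<K))))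
                    (attach-adj u-boundary)

          near-u : ∀ {x} → Move G u x → Near (c [ d ]≔ u) x
          near-u mv = d , subst (λ z → Move G z _) (sym ([]≔-at c d u)) mv

          guards : Guarded m p (c [ d ]≔ u)
          guards = Guarded-move (≤-reflexive (sym (toℕ-fromℕ< m<K))) (Guarded-weaken (n≤1+n m) g)

          respond : ∀ {r′} → Move G a r′ → ¬ Near (c [ d ]≔ u) r′ → CopsWin G K (c [ d ]≔ u) r′
          respond mv ¬near with step-or-boundary a-safe [] mv
          ... | inj₁ w  = ⊥-elim (¬near (near-u (inj₂ (dominates-territory w))))
          ... | inj₂ bd with m≤n⇒m<n∨m≡n (attach≤m bd)
          ...   | inj₁ below = ⊥-elim (¬near (guard-near guards (<⇒≤ m<K) below (inj₂ (attach-adj bd))))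
          ...   | inj₂ at-m  = ⊥-elim (no-escape bd at-m (¬near ∘ near-u ∘ inj₁) (¬near ∘ near-u ∘ inj₂))

    win : ∀ {c} → Guarded L p c → CopsWin G K c a
    win g with m≤n⇒m<n∨m≡n m<K
    ... | inj₁ 1+m<K = Travel.win 1+m<K (Guarded-weaken m<L g)
    ... | inj₂ 1+m≡K = Dominate.win 1+m≡K (Guarded-weaken m<L g)

  wins : ∀ N → WinsBelow N
  wins zero    _  _ _      ()
  wins (suc N) gp g r-safe bound = Phase.win (wins N) gp r-safe (≤-pred bound) g

  strategy : CopNumber≤ G K
  strategy = (λ _ → v₀) , λ r → capture-or λ ¬near →
    wins _ start on-v₀ (guarded⇒safe on-v₀ (s≤s z≤n) ¬near) ≤-refl
    where
      v₀ : V
      v₀ = proj₁ conn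

      start : GuardablePath 1 (λ _ → v₀)
      start = record { induced = single-induced v₀ ; nonempty = s≤s z≤n ; fits = s≤s z≤n }

      on-v₀ : Guarded 1 (λ _ → v₀) (λ _ → v₀)
      on-v₀ = guarded λ _ _ → refl

theorem3 : (k : ℕ) → 5 ≤ k → (G : Graph) → Connected G →
             ¬ HasInducedPath G k → ¬ HasInducedClaw G →
             CopNumber≤ G (k ∸ 3)
theorem3 (suc (suc (suc (suc (suc j))))) (s≤s (s≤s (s≤s (s≤s (s≤s z≤n))))) G conn noP noC =
  Strategy.strategy G j conn noP noC
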